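{- Let $G$ be a finite bicolored digraph, let $C_1$ and $C_2$ be its sets of 1-cyclic classes and 2-cyclic classes, let $M_1$ be the set of maximal elements of $(C_1,\le_1)$ and $M_2$ the set of minimal elements of $(C_2,\le_2)$. Then $G$ has a bikernel if and only if there exists a bijection $f:M_1\to M_2$ such that $f(m_1)\cap m_1\neq\emptyset$ for all $m_1\in M_1$.
   Context: A bicolored digraph has each arc colored $1$ or $2$. For $i\in\{1,2\}$ define on $V(G)$: $u\sim_i v$ iff $u=v$ or there exist a directed $uv$-path and a directed $vu$-path both of color $i$ (all arcs color $i$). This is an equivalence relation; its classes $[u]_i$ are the $i$-cyclic classes, and $C_i=\{[c]_i: c\in V(G)\}$. Partially order $C_i$ by $[u]_i\le_i[v]_i$ iff $u=v$ or there is a directed $uv$-path of color $i$. A non-empty $B\subseteq V(G)$ is a bikernel (by monochromatic paths) if: (i) for all distinct $u,v\in B$ there is no monochromatic directed $uv$-path; (ii) for every $v\in V(G)\setminus B$ there is a directed path of color $1$ from $v$ to a vertex of $B$; (iii) for every $v\in V(G)\setminus B$ there is a directed path of color $2$ from a vertex of $B$ to $v$. -}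

module Defs where

open import Data.Nat using (ℕ; suc)
open import Data.Fin using (Fin)
open import Data.Fin.Subset using (Subset; _∈_; _∉_)
open import Data.Maybe using (Maybe; just)
open import Data.Product using (Σ; ∃; _×_; _,_; proj₁)
open import Data.Sum using (_⊎_; inj₁; inj₂)
open import Relation.Nullary using (¬_)
open import Relation.Binary.PropositionalEquality using (_≡_; refl; sym; trans)
open import Relation.Binary.Bundles using (Setoid)
open import Relation.Binary.Structures using (IsEquivalence)
open import Function.Bundles using (Bijection)

data Color : Set where
  c1 c2 : Color

-- A finite bicolored digraph on the (non-empty) vertex set Fin (suc n):
-- arc u v = just i  means there is an arc u → v of colour i,
-- arc u v = nothing means there is no arc u → v.
BiDigraph : ℕ → Set
BiDigraph n = Fin (suc n) → Fin (suc n) → Maybe Color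

module _ {n : ℕ} (G : BiDigraph n) where

  V : Set
  V = Fin (suc n)

  -- Non-trivial directed walk from u to v all of whose arcs have colour i.
  -- (Existence of such a walk between distinct vertices is equivalent to the
  -- existence of a directed path of colour i.)
  data Walk (i : Color) : V → V → Set where
    arc   : ∀ {u v} → G u v ≡ just i → Walk i u v
    _◅_   : ∀ {u w v} → G u w ≡ just i → Walk i w v → Walk i u v

  walk-trans : ∀ {i u w v} → Walk i u w → Walk i w v → Walk i u v
  walk-trans (arc e)   q = e ◅ q
  walk-trans (e ◅ p)   q = e ◅ walk-trans p q

  _∼[_]_ : V → Color → V → Set
  u ∼[ i ] v = u ≡ v ⊎ (Walk i u v × Walk i v u)

  ∼-refl : ∀ {i u} → u ∼[ i ] u
  ∼-refl = inj₁ refl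

  ∼-sym : ∀ {i u v} → u ∼[ i ] v → v ∼[ i ] u
  ∼-sym (inj₁ e)       = inj₁ (sym e)
  ∼-sym (inj₂ (p , q)) = inj₂ (q , p)

  ∼-trans : ∀ {i u v w} → u ∼[ i ] v → v ∼[ i ] w → u ∼[ i ] w
  ∼-trans (inj₁ refl) q = q
  ∼-trans (inj₂ pq) (inj₁ refl) = inj₂ pq
  ∼-trans (inj₂ (p , p')) (inj₂ (q , q')) = inj₂ (walk-trans p q , walk-trans q' p')

  -- [u]_i ≤_i [v]_i   (stated on representatives; independent of the choice)
  Le : Color → V → V → Set
  Le i u v = u ≡ v ⊎ Walk i u v

  IsMax₁ : V → Set
  IsMax₁ u = ∀ v → Le c1 u v → u ∼[ c1 ] v

  IsMin₂ : V → Set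
  IsMin₂ u = ∀ v → Le c2 v u → v ∼[ c2 ] u

  -- M_1: the set of maximal 1-cyclic classes, as a setoid
  -- (representatives of maximal classes, identified up to ∼₁).
  M₁ : Setoid _ _
  M₁ = record
    { Carrier = Σ V IsMax₁
    ; _≈_ = λ a b → proj₁ a ∼[ c1 ] proj₁ b
    ; isEquivalence = record { refl = ∼-refl ; sym = ∼-sym ; trans = ∼-trans }
    }

  M₂ : Setoid _ _
  M₂ = record
    { Carrier = Σ V IsMin₂
    ; _≈_ = λ a b → proj₁ a ∼[ c2 ] proj₁ b
    ; isEquivalence = record { refl = ∼-refl ; sym = ∼-sym ; trans = ∼-trans }
    }

  -- Monochromatic directed path from u to v (u ≠ v intended by callers).
  MonoPath : V → V → Set
  MonoPath u v = Walk c1 u v ⊎ Walk c2 u v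

  IsBikernel : Subset (suc n) → Set
  IsBikernel B =
      (∃ λ b → b ∈ B)
    × (∀ u v → u ∈ B → v ∈ B → ¬ (u ≡ v) → ¬ MonoPath u v)
    × (∀ v → v ∉ B → ∃ λ b → b ∈ B × Walk c1 v b)
    × (∀ v → v ∉ B → ∃ λ b → b ∈ B × Walk c2 b v)

  HasBikernel : Set
  HasBikernel = ∃ IsBikernel

  Meets : Setoid.Carrier M₁ → Setoid.Carrier M₂ → Set
  Meets a b = ∃ λ w → (w ∼[ c1 ] proj₁ a) × (w ∼[ c2 ] proj₁ b)

-- A bikernel B picks exactly one vertex from every maximal 1-class and from every minimal
-- 2-class: its vertices are 1-maximal (a 1-path leaving b ∈ B could only be absorbed back
-- into b) and 2-minimal, absorption and domination put a vertex of B into each such class,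
-- and independence allows at most one.  Sending a maximal 1-class to the 2-class of its
-- vertex of B is the required bijection.  Conversely, given such a bijection f, choose in
-- every maximal 1-class m one vertex of m ∩ f(m).  The chosen vertices are independent,
-- since a 1-path cannot leave a maximal 1-class and a 2-path cannot enter a minimal
-- 2-class, so both ends of a 2-path lie in the same class f(m) and injectivity of f
-- applies.  Absorption and domination hold because in a finite digraph every vertex lies
-- below some maximal 1-class and above some minimal 2-class.
module Submission where

open import Defs
open import Data.Nat using (ℕ; suc)
open import Data.Fin using (Fin; zero; _≤_)
open import Data.Fin.Properties using (_≟_; _≤?_; ≤-isPreorder; ≤-total; ≤-antisym; any?; all?)
open import Data.Fin.Induction using (spo-noetherian)
open import Data.Fin.Subset using (Subset; _∈_; _∉_)
open import Data.Fin.Subset.Properties using (_∈?_)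
open import Data.List using (List; []; _∷_; allFin)
open import Data.List.Membership.Propositional using () renaming (_∈_ to _∈ₗ_)
open import Data.List.Membership.Propositional.Properties using (∈-allFin)
open import Data.List.Relation.Unary.Any using (here; there)
open import Data.Maybe using (just)
open import Data.Maybe.Properties using (≡-dec)
open import Data.Product using (Σ; ∃; _×_; _,_; proj₁; proj₂; map₁)
open import Data.Unit using (tt)
open import Data.Sum as Sum using (_⊎_; inj₁; inj₂; [_,_]′)
open import Data.Vec using (tabulate)
open import Data.Vec.Properties using (lookup∘tabulate; lookup⇒[]=; []=⇒lookup)
open import Function using (_∘_; flip; id)
open import Function.Bundles using (Bijection; _⇔_; mk⇔)
open import Induction.WellFounded using (Acc; acc)
open import Level using (_⊔_; 0ℓ)
open import Relation.Binary.Core using (Rel)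
open import Relation.Binary.Definitions using (Decidable; DecidableEquality)
open import Relation.Binary.Structures using (IsPreorder; IsStrictPartialOrder)
open import Relation.Binary.Construct.Closure.Transitive using (TransClosure; [_]; _∷_)
import Relation.Binary.Construct.Flip.EqAndOrd as Flip
open import Relation.Binary.PropositionalEquality using (_≡_; refl; sym; trans; subst; isEquivalence; resp₂)
open import Relation.Nullary using (¬_; Dec; yes; no; contradiction)
open import Relation.Nullary.Decidable
  using (map′; _×-dec_; _⊎-dec_; _→-dec_; ¬?; decidable-stable; dec-true)
open import Relation.Unary using (Pred) renaming (Decidable to Decidable₁)

module _ {k r} {_≲_ : Rel (Fin k) r} (_≲?_ : Decidable _≲_) (≲-isPreorder : IsPreorder _≡_ _≲_) where

  private
    module ≲ = IsPreorder ≲-isPreorder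

    _⊏_ : Rel (Fin k) r
    u ⊏ v = u ≲ v × ¬ v ≲ u

    ⊏-isStrictPartialOrder : IsStrictPartialOrder _≡_ _⊏_
    ⊏-isStrictPartialOrder = record
      { isEquivalence = isEquivalence
      ; irrefl        = λ { refl (u≲u , u≴u) → u≴u u≲u }
      ; trans         = λ (u≲v , v≴u) (v≲w , w≴v) → ≲.trans u≲v v≲w , λ w≲u → w≴v (≲.trans w≲u u≲v)
      ; <-resp-≈      = resp₂ _⊏_
      }

  maximal-above : ∀ {p} {P : Pred (Fin k) p} → Decidable₁ P → ∀ {v} → P v →
                  ∃ λ m → P m × v ≲ m × (∀ w → P w → m ≲ w → w ≲ m)
  maximal-above {P = P} P? {v} = go (spo-noetherian ⊏-isStrictPartialOrder v)
    where
    go : ∀ {v} → Acc (flip _⊏_) v → P v → ∃ λ m → P m × v ≲ m × (∀ w → P w → m ≲ w → w ≲ m)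
    go {v} (acc above) Pv with any? (λ w → P? w ×-dec (v ≲? w ×-dec ¬? (w ≲? v)))
    ... | yes (w , Pw , v⊏w) =
      let m , Pm , w≲m , m-max = go (above v⊏w) Pw in m , Pm , ≲.trans (proj₁ v⊏w) w≲m , m-max
    ... | no ¬bigger =
      v , Pv , ≲.refl , λ w Pw v≲w → decidable-stable (w ≲? v) (λ w≴v → ¬bigger (w , Pw , v≲w , w≴v))

decSubset : ∀ {k p} {P : Pred (Fin k) p} → Decidable₁ P → Subset k
decSubset P? = tabulate (λ x → Dec.does (P? x))

∈-decSubset⁺ : ∀ {k p} {P : Pred (Fin k) p} (P? : Decidable₁ P) {x} → P x → x ∈ decSubset P?
∈-decSubset⁺ P? {x} Px = lookup⇒[]= x _ (trans (lookup∘tabulate _ x) (dec-true (P? x) Px))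

∈-decSubset⁻ : ∀ {k p} {P : Pred (Fin k) p} (P? : Decidable₁ P) {x} → x ∈ decSubset P? → P x
∈-decSubset⁻ P? {x} x∈ with P? x | trans (sym (lookup∘tabulate _ x)) ([]=⇒lookup x∈)
... | yes Px | _  = Px
... | no _   | ()

module _ {a ℓ} {A : Set a} {_⟶_ : Rel A ℓ} where

  -- Floyd–Warshall: non-empty walks whose interior vertices all lie in L.
  data Through (L : List A) : Rel A (a ⊔ ℓ) where
    [_]     : ∀ {x y} → x ⟶ y → Through L x y
    _∷⟨_⟩_ : ∀ {x y z} → x ⟶ y → y ∈ₗ L → Through L y z → Through L x z

  through-++ : ∀ {L x y z} → Through L x y → y ∈ₗ L → Through L y z → Through L x z
  through-++ [ x⟶y ]          y∈L q = x⟶y ∷⟨ y∈L ⟩ q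
  through-++ (x⟶w ∷⟨ w∈L ⟩ p) y∈L q = x⟶w ∷⟨ w∈L ⟩ through-++ p y∈L q

  through-weaken : ∀ {v L x y} → Through L x y → Through (v ∷ L) x y
  through-weaken [ x⟶y ]          = [ x⟶y ]
  through-weaken (x⟶w ∷⟨ w∈L ⟩ p) = x⟶w ∷⟨ there w∈L ⟩ through-weaken p

  -- A walk that does visit v is cut at its first and its last visit to v.
  through-split : ∀ {v L x z} → Through (v ∷ L) x z → Through L x z ⊎ (Through L x v × Through L v z)
  through-split [ x⟶z ] = inj₁ [ x⟶z ]
  through-split (x⟶v ∷⟨ here refl ⟩ p) = inj₂ ([ x⟶v ] , [ id , proj₂ ]′ (through-split p))
  through-split (x⟶y ∷⟨ there y∈L ⟩ p) =
    Sum.map (x⟶y ∷⟨ y∈L ⟩_) (map₁ (x⟶y ∷⟨ y∈L ⟩_)) (through-split p)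

  through-join : ∀ {v L x z} → Through L x z ⊎ (Through L x v × Through L v z) → Through (v ∷ L) x z
  through-join (inj₁ p)       = through-weaken p
  through-join (inj₂ (p , q)) = through-++ (through-weaken p) (here refl) (through-weaken q)

  through? : Decidable _⟶_ → ∀ L → Decidable (Through L)
  through? _⟶?_ []      x z = map′ [_] (λ { [ x⟶z ] → x⟶z ; (_ ∷⟨ () ⟩ _) }) (x ⟶? z)
  through? _⟶?_ (v ∷ L) x z =
    map′ through-join through-split
      (through? _⟶?_ L x z ⊎-dec (through? _⟶?_ L x v ×-dec through? _⟶?_ L v z))

  through⇒⁺ : ∀ {L x y} → Through L x y → TransClosure _⟶_ x y
  through⇒⁺ [ x⟶y ]        = [ x⟶y ]
  through⇒⁺ (x⟶w ∷⟨ _ ⟩ p) = x⟶w ∷ through⇒⁺ p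

  ⁺⇒through : ∀ {L} → (∀ y → y ∈ₗ L) → ∀ {x z} → TransClosure _⟶_ x z → Through L x z
  ⁺⇒through everywhere [ x⟶z ]   = [ x⟶z ]
  ⁺⇒through everywhere (x⟶y ∷ p) = x⟶y ∷⟨ everywhere _ ⟩ ⁺⇒through everywhere p

transClosure? : ∀ {k ℓ} {_⟶_ : Rel (Fin k) ℓ} → Decidable _⟶_ → Decidable (TransClosure _⟶_)
transClosure? {k} _⟶?_ x z =
  map′ through⇒⁺ (⁺⇒through ∈-allFin) (through? _⟶?_ (allFin k) x z)

_≟ᶜ_ : DecidableEquality Color
c1 ≟ᶜ c1 = yes refl
c1 ≟ᶜ c2 = no λ ()
c2 ≟ᶜ c1 = no λ ()
c2 ≟ᶜ c2 = yes refl

module _ {n : ℕ} (G : BiDigraph n) where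

  infix 4 _∼⟨_⟩_
  _∼⟨_⟩_ : V G → Color → V G → Set
  u ∼⟨ i ⟩ v = _∼[_]_ G u i v

  Max₁ : Set
  Max₁ = Σ (V G) (IsMax₁ G)

  Min₂ : Set
  Min₂ = Σ (V G) (IsMin₂ G)

  Arc : Color → Rel (V G) 0ℓ
  Arc i u v = G u v ≡ just i

  walk⇒⁺ : ∀ {i u v} → Walk G i u v → TransClosure (Arc i) u v
  walk⇒⁺ (arc e)  = [ e ]
  walk⇒⁺ (e ◅ p) = e ∷ walk⇒⁺ p

  ⁺⇒walk : ∀ {i u v} → TransClosure (Arc i) u v → Walk G i u v
  ⁺⇒walk [ e ]   = arc e
  ⁺⇒walk (e ∷ p) = e ◅ ⁺⇒walk p

  walk? : ∀ i → Decidable (Walk G i)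
  walk? i u v = map′ ⁺⇒walk walk⇒⁺ (transClosure? (λ x y → ≡-dec _≟ᶜ_ (G x y) (just i)) u v)

  Le? : ∀ i → Decidable (Le G i)
  Le? i u v = (u ≟ v) ⊎-dec walk? i u v

  ∼? : ∀ i u v → Dec (u ∼⟨ i ⟩ v)
  ∼? i u v = (u ≟ v) ⊎-dec (walk? i u v ×-dec walk? i v u)

  monoPath : ∀ {i u v} → Walk G i u v → MonoPath G u v
  monoPath {c1} = inj₁
  monoPath {c2} = inj₂

  Le-trans : ∀ {i u v w} → Le G i u v → Le G i v w → Le G i u w
  Le-trans (inj₁ refl) v≲w         = v≲w
  Le-trans (inj₂ u⟶v) (inj₁ refl) = inj₂ u⟶v
  Le-trans (inj₂ u⟶v) (inj₂ v⟶w) = inj₂ (walk-trans G u⟶v v⟶w)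

  Le-isPreorder : ∀ i → IsPreorder _≡_ (Le G i)
  Le-isPreorder i = record { isEquivalence = isEquivalence ; reflexive = inj₁ ; trans = Le-trans }

  Le-antisym : ∀ {i u v} → Le G i u v → Le G i v u → u ∼⟨ i ⟩ v
  Le-antisym (inj₁ u≡v) _           = inj₁ u≡v
  Le-antisym (inj₂ _)   (inj₁ v≡u)  = inj₁ (sym v≡u)
  Le-antisym (inj₂ u⟶v) (inj₂ v⟶u) = inj₂ (u⟶v , v⟶u)

  ∼⇒Le : ∀ {i u v} → u ∼⟨ i ⟩ v → Le G i u v
  ∼⇒Le (inj₁ u≡v)      = inj₁ u≡v
  ∼⇒Le (inj₂ (u⟶v , _)) = inj₂ u⟶v

  Le-Le-≢⇒walk : ∀ {i u v w} → Le G i u v → Le G i v w → ¬ u ≡ w → Walk G i u w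
  Le-Le-≢⇒walk u≲v v≲w u≢w with Le-trans u≲v v≲w
  ... | inj₁ u≡w  = contradiction u≡w u≢w
  ... | inj₂ u⟶w = u⟶w

  IsMax₁-resp : ∀ {u v} → IsMax₁ G u → u ∼⟨ c1 ⟩ v → IsMax₁ G v
  IsMax₁-resp u-max u∼v w v≲w = ∼-trans G (∼-sym G u∼v) (u-max w (Le-trans (∼⇒Le u∼v) v≲w))

  IsMin₂-resp : ∀ {u v} → IsMin₂ G u → u ∼⟨ c2 ⟩ v → IsMin₂ G v
  IsMin₂-resp u-min u∼v w w≲v = ∼-trans G (u-min w (Le-trans w≲v (∼⇒Le (∼-sym G u∼v)))) u∼v

  IsMax₁? : Decidable₁ (IsMax₁ G)
  IsMax₁? u = all? (λ v → Le? c1 u v →-dec ∼? c1 u v)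

  max₁-above : ∀ v → ∃ λ m → Le G c1 v m × IsMax₁ G m
  max₁-above v with maximal-above (Le? c1) (Le-isPreorder c1) (λ _ → yes tt) tt
  ... | m , _ , v≲m , m-max = m , v≲m , λ w m≲w → Le-antisym m≲w (m-max w tt m≲w)

  min₂-below : ∀ v → ∃ λ m → Le G c2 m v × IsMin₂ G m
  min₂-below v
    with maximal-above (flip (Le? c2)) (Flip.isPreorder (Le-isPreorder c2)) (λ _ → yes tt) tt
  ... | m , _ , m≲v , m-min = m , m≲v , λ w w≲m → Le-antisym w≲m (m-min w tt w≲m)

  module FromBikernel {B : Subset (suc n)} (isBikernel : IsBikernel G B) where

    private
      independent : ∀ u v → u ∈ B → v ∈ B → ¬ u ≡ v → ¬ MonoPath G u v
      independent = proj₁ (proj₂ isBikernel)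

      absorbing : ∀ v → v ∉ B → ∃ λ b → b ∈ B × Walk G c1 v b
      absorbing = proj₁ (proj₂ (proj₂ isBikernel))

      dominating : ∀ v → v ∉ B → ∃ λ b → b ∈ B × Walk G c2 b v
      dominating = proj₂ (proj₂ (proj₂ isBikernel))

    Le-in-B⇒≡ : ∀ {i b b′} → b ∈ B → b′ ∈ B → Le G i b b′ → b ≡ b′
    Le-in-B⇒≡ _ _ (inj₁ b≡b′) = b≡b′
    Le-in-B⇒≡ {b = b} {b′} b∈B b′∈B (inj₂ b⟶b′) =
      decidable-stable (b ≟ b′) (λ b≢b′ → independent b b′ b∈B b′∈B b≢b′ (monoPath b⟶b′))

    ∼-in-B⇒≡ : ∀ {i b b′} → b ∈ B → b′ ∈ B → b ∼⟨ i ⟩ b′ → b ≡ b′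
    ∼-in-B⇒≡ b∈B b′∈B = Le-in-B⇒≡ b∈B b′∈B ∘ ∼⇒Le

    below-B₁ : ∀ v → ∃ λ b → b ∈ B × Le G c1 v b
    below-B₁ v with v ∈? B
    ... | yes v∈B = v , v∈B , inj₁ refl
    ... | no v∉B  = let b , b∈B , v⟶b = absorbing v v∉B in b , b∈B , inj₂ v⟶b

    above-B₂ : ∀ v → ∃ λ b → b ∈ B × Le G c2 b v
    above-B₂ v with v ∈? B
    ... | yes v∈B = v , v∈B , inj₁ refl
    ... | no v∉B  = let b , b∈B , b⟶v = dominating v v∉B in b , b∈B , inj₂ b⟶v

    ∈B⇒IsMax₁ : ∀ {b} → b ∈ B → IsMax₁ G b
    ∈B⇒IsMax₁ b∈B v b≲v with below-B₁ v
    ... | b′ , b′∈B , v≲b′ with Le-in-B⇒≡ b∈B b′∈B (Le-trans b≲v v≲b′)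
    ... | refl = Le-antisym b≲v v≲b′

    ∈B⇒IsMin₂ : ∀ {b} → b ∈ B → IsMin₂ G b
    ∈B⇒IsMin₂ b∈B v v≲b with above-B₂ v
    ... | b′ , b′∈B , b′≲v with Le-in-B⇒≡ b′∈B b∈B (Le-trans b′≲v v≲b)
    ... | refl = Le-antisym v≲b b′≲v

    B-meets-max₁ : ∀ (m : Max₁) → ∃ λ b → b ∈ B × b ∼⟨ c1 ⟩ proj₁ m
    B-meets-max₁ (m , m-max) =
      let b , b∈B , m≲b = below-B₁ m in b , b∈B , ∼-sym G (m-max b m≲b)

    B-meets-min₂ : ∀ (m : Min₂) → ∃ λ b → b ∈ B × b ∼⟨ c2 ⟩ proj₁ m
    B-meets-min₂ (m , m-min) =
      let b , b∈B , b≲m = above-B₂ m in b , b∈B , m-min b b≲m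

    matching : Bijection (M₁ G) (M₂ G)
    matching = record
      { to        = to
      ; cong      = λ {x} {y} x∼y → inj₁ (same-B x y x∼y)
      ; bijective = (λ {x} {y} → injective x y) , surjective
      }
      where
      to : Max₁ → Min₂
      to m = let b , b∈B , _ = B-meets-max₁ m in b , ∈B⇒IsMin₂ b∈B

      same-B : ∀ x y → proj₁ x ∼⟨ c1 ⟩ proj₁ y → proj₁ (to x) ≡ proj₁ (to y)
      same-B x y x∼y =
        let bx , bx∈B , bx∼x = B-meets-max₁ x ; by , by∈B , by∼y = B-meets-max₁ y
        in ∼-in-B⇒≡ bx∈B by∈B (∼-trans G bx∼x (∼-trans G x∼y (∼-sym G by∼y)))

      injective : ∀ x y → proj₁ (to x) ∼⟨ c2 ⟩ proj₁ (to y) → proj₁ x ∼⟨ c1 ⟩ proj₁ y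
      injective x y tx∼ty =
        let bx , bx∈B , bx∼x = B-meets-max₁ x ; by , by∈B , by∼y = B-meets-max₁ y
        in ∼-trans G (∼-sym G bx∼x) (subst (_∼⟨ c1 ⟩ proj₁ y) (sym (∼-in-B⇒≡ bx∈B by∈B tx∼ty)) by∼y)

      surjective : ∀ y → ∃ λ x → ∀ {z} → proj₁ z ∼⟨ c1 ⟩ proj₁ x → proj₁ (to z) ∼⟨ c2 ⟩ proj₁ y
      surjective y with B-meets-min₂ y
      ... | b , b∈B , b∼y = (b , ∈B⇒IsMax₁ b∈B) , λ {z} z∼b →
        let bz , bz∈B , bz∼z = B-meets-max₁ z
        in subst (_∼⟨ c2 ⟩ proj₁ y) (sym (∼-in-B⇒≡ bz∈B b∈B (∼-trans G bz∼z z∼b))) b∼y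

    matching-meets : ∀ m → Meets G m (Bijection.to matching m)
    matching-meets m = let b , _ , b∼m = B-meets-max₁ m in b , b∼m , ∼-refl G

  module FromMatching (f : Bijection (M₁ G) (M₂ G)) (meets : ∀ m → Meets G m (Bijection.to f m)) where

    open Bijection f using (to; injective; surjective) renaming (cong to to-cong)

    Candidate : V G → Set
    Candidate w = Σ (IsMax₁ G w) λ w-max → proj₁ (to (w , w-max)) ∼⟨ c2 ⟩ w

    candidate? : Decidable₁ Candidate
    candidate? w with IsMax₁? w
    ... | no ¬max = no (¬max ∘ proj₁)
    ... | yes max =
      map′ (max ,_) (λ (max′ , fw∼w) → ∼-trans G (to-cong {w , max} {w , max′} (∼-refl G)) fw∼w)
        (∼? c2 (proj₁ (to (w , max))) w)

    -- One candidate per 1-class: the one of largest index.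
    Chosen : V G → Set
    Chosen w = Candidate w × (∀ w′ → Candidate w′ → w′ ∼⟨ c1 ⟩ w → w ≤ w′ → w′ ≤ w)

    chosen? : Decidable₁ Chosen
    chosen? w = candidate? w ×-dec all? λ w′ → candidate? w′ →-dec (∼? c1 w′ w →-dec (w ≤? w′ →-dec w′ ≤? w))

    chosen-unique : ∀ {u v} → Chosen u → Chosen v → u ∼⟨ c1 ⟩ v → u ≡ v
    chosen-unique {u} {v} (u-cand , u-largest) (v-cand , v-largest) u∼v with ≤-total u v
    ... | inj₁ u≤v = ≤-antisym u≤v (u-largest v v-cand (∼-sym G u∼v) u≤v)
    ... | inj₂ v≤u = ≤-antisym (v-largest u u-cand u∼v v≤u) v≤u

    candidate-in-class : ∀ (m : Max₁) → ∃ λ w → Candidate w × w ∼⟨ c1 ⟩ proj₁ m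
    candidate-in-class m =
      let w , w∼m , w∼fm = meets m
          w-max = IsMax₁-resp (proj₂ m) (∼-sym G w∼m)
      in w , (w-max , ∼-trans G (to-cong {w , w-max} {m} w∼m) (∼-sym G w∼fm)) , w∼m

    chosen-in-class : ∀ (m : Max₁) → ∃ λ b → Chosen b × b ∼⟨ c1 ⟩ proj₁ m
    chosen-in-class m =
      let w , w-cand , w∼m = candidate-in-class m
          b , (b-cand , b∼w) , _ , b-largest =
            maximal-above _≤?_ ≤-isPreorder (λ w′ → candidate? w′ ×-dec ∼? c1 w′ w) (w-cand , ∼-refl G)
      in b , (b-cand , λ w′ w′-cand w′∼b → b-largest w′ (w′-cand , ∼-trans G w′∼b b∼w)) , ∼-trans G b∼w w∼m

    kernel : Subset (suc n)
    kernel = decSubset chosen?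

    kernel-meets-max₁ : ∀ (m : Max₁) → ∃ λ b → b ∈ kernel × b ∼⟨ c1 ⟩ proj₁ m
    kernel-meets-max₁ m = let b , b-chosen , b∼m = chosen-in-class m in b , ∈-decSubset⁺ chosen? b-chosen , b∼m

    chosen-walk⇒≡ : ∀ {i u v} → Chosen u → Chosen v → Walk G i u v → u ≡ v
    chosen-walk⇒≡ {c1} {v = v} u-chosen v-chosen u⟶v =
      chosen-unique u-chosen v-chosen (proj₁ (proj₁ u-chosen) v (inj₂ u⟶v))
    chosen-walk⇒≡ {c2} {u} {v} u-chosen@((u-max , fu∼u) , _) v-chosen@((v-max , fv∼v) , _) u⟶v =
      chosen-unique u-chosen v-chosen
        (injective {u , u-max} {v , v-max} (∼-trans G fu∼u (∼-trans G u∼v (∼-sym G fv∼v))))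
      where
      u∼v : u ∼⟨ c2 ⟩ v
      u∼v = IsMin₂-resp (proj₂ (to (v , v-max))) fv∼v u (inj₂ u⟶v)

    kernel-meets-min₂ : ∀ (y : Min₂) → ∃ λ b → b ∈ kernel × b ∼⟨ c2 ⟩ proj₁ y
    kernel-meets-min₂ y =
      let x , x↦y = surjective y
          b , b∈ , b∼x = kernel-meets-max₁ x
          (b-max , fb∼b) , _ = ∈-decSubset⁻ chosen? b∈
      in b , b∈ , ∼-trans G (∼-sym G fb∼b) (x↦y {b , b-max} b∼x)

    kernel-isBikernel : IsBikernel G kernel
    kernel-isBikernel = nonempty , independent , absorbing , dominating
      where
      ∉-≢ : ∀ {v b} → v ∉ kernel → b ∈ kernel → ¬ v ≡ b
      ∉-≢ v∉ b∈ refl = v∉ b∈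

      nonempty : ∃ λ b → b ∈ kernel
      nonempty = let m , _ , m-max = max₁-above zero ; b , b∈ , _ = kernel-meets-max₁ (m , m-max) in b , b∈

      independent : ∀ u v → u ∈ kernel → v ∈ kernel → ¬ u ≡ v → ¬ MonoPath G u v
      independent u v u∈ v∈ u≢v = u≢v ∘ [ chosen-walk⇒≡ u-chosen v-chosen , chosen-walk⇒≡ u-chosen v-chosen ]′
        where
        u-chosen : Chosen u
        u-chosen = ∈-decSubset⁻ chosen? u∈

        v-chosen : Chosen v
        v-chosen = ∈-decSubset⁻ chosen? v∈

      absorbing : ∀ v → v ∉ kernel → ∃ λ b → b ∈ kernel × Walk G c1 v b
      absorbing v v∉ =
        let m , v≲m , m-max = max₁-above v ; b , b∈ , b∼m = kernel-meets-max₁ (m , m-max)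
        in b , b∈ , Le-Le-≢⇒walk v≲m (∼⇒Le (∼-sym G b∼m)) (∉-≢ v∉ b∈)

      dominating : ∀ v → v ∉ kernel → ∃ λ b → b ∈ kernel × Walk G c2 b v
      dominating v v∉ =
        let m , m≲v , m-min = min₂-below v ; b , b∈ , b∼m = kernel-meets-min₂ (m , m-min)
        in b , b∈ , Le-Le-≢⇒walk (∼⇒Le b∼m) m≲v (∉-≢ v∉ b∈ ∘ sym)

mainTheorem14 : (n : ℕ) (G : BiDigraph n) →
    HasBikernel G ⇔ Σ (Bijection (M₁ G) (M₂ G)) (λ f → ∀ m → Meets G m (Bijection.to f m))
mainTheorem14 n G = mk⇔
  (λ (B , isBikernel) → FromBikernel.matching G isBikernel , FromBikernel.matching-meets G isBikernel)
  (λ (f , meets) → FromMatching.kernel G f meets , FromMatching.kernel-isBikernel G f meets)
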